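{- Let $a_1,a_2\in\mathbb{Z}$ with $a_1>0$, and let $(f_n)_{n\ge0}$ be defined by $f_0=1$, $f_h=0$ for $h<0$, and $f_n=a_1f_{n-1}+a_2f_{n-2}$ for $n\ge1$. Define integers $q_2,r_2$ as follows: if $a_1+a_2\le 0$, let $q_2,r_2$ be positive integers with $|a_1+a_2|=q_2a_1-r_2$; otherwise let $q_2=0$ and $r_2=a_1+a_2$. Consider the succession rule (all jumps equal to $1$) with label types $A$ (value $a_1$), $R$ (value $r_2$) and $Z$ (value $0$), root $A$, and productions $$(a_1)\rightsquigarrow (0)^{q_2}(r_2)(a_1)^{a_1-(q_2+1)},\qquad (r_2)\rightsquigarrow \big((0)^{q_2}(r_2)\big)^{q_2}(0)^{q_2}(r_2)(a_1)^{r_2-(q_2+1)^2},$$ where the label $(0)$ produces no children. That is: a node of type $A$ has $q_2$ children of type $Z$, one child of type $R$, and $a_1-(q_2+1)$ (signed) children of type $A$; a node of type $R$ has $q_2(q_2+1)$ children of type $Z$, $q_2+1$ children of type $R$, and $r_2-(q_2+1)^2$ (signed) children of type $A$; a node of type $Z$ has no children. Then the signed level counts $F_n$ of this rule satisfy $F_n=f_n$ for all $n\ge0$.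
   Context: A succession rule (possibly with marked labels) is given by a set of label types, a root type, and for each pair of label types $t,t'$ an integer multiplicity $m(t,t')$. Its generating tree: the root has the root type, weight $+1$, level $0$; a node of type $t$ and weight $\varepsilon\in\{\pm1\}$ at level $n$ has, for each $t'$ with $m(t,t')\ne0$, exactly $|m(t,t')|$ children of type $t'$ at level $n+1$, each of weight $\varepsilon\cdot\mathrm{sign}(m(t,t'))$. The notation $(t)^m$ with $m<0$ denotes $|m|$ marked copies (weight $-1$). Distinct label types are kept distinct even if their numerical values coincide. The signed level count $F_n$ is the sum of the weights of all nodes (including nodes of type $Z$) at level $n$. -}

module Defs where

open import Data.Nat using (ℕ; zero; suc)
open import Data.Integer using (ℤ; +_; _+_; _*_; _-_; ∣_∣; sign; _◃_; _≤_; _<_)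
open import Data.Sign using (Sign) renaming (_*_ to _*ₛ_)
open import Data.List using (List; []; _∷_; _++_; replicate; concatMap; map; foldr)
open import Data.Product using (_×_; _,_; proj₂)
open import Data.Sum using (_⊎_)
open import Relation.Binary.PropositionalEquality using (_≡_)

-- Label types of the succession rule (kept distinct even if values coincide).
data Label : Set where
  A R Z : Label

allLabels : List Label
allLabels = A ∷ R ∷ Z ∷ []

record SuccessionRule : Set where
  field
    root : Label
    mult : Label → Label → ℤ

Node : Set
Node = Label × Sign

children : SuccessionRule → Node → List Node
children P (t , ε) =
  concatMap (λ t' → replicate ∣ SuccessionRule.mult P t t' ∣
                      (t' , ε *ₛ sign (SuccessionRule.mult P t t')))
            allLabels

level : SuccessionRule → ℕ → List Node
level P zero    = (SuccessionRule.root P , Sign.+) ∷ []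
level P (suc n) = concatMap (children P) (level P n)

sumℤ : List ℤ → ℤ
sumℤ = foldr _+_ (+ 0)

F : SuccessionRule → ℕ → ℤ
F P n = sumℤ (map (λ x → proj₂ x ◃ 1) (level P n))

rule : ℤ → ℤ → ℤ → SuccessionRule
rule a₁ q₂ r₂ = record { root = A ; mult = m }
  where
  m : Label → Label → ℤ
  m A Z = q₂
  m A R = + 1
  m A A = a₁ - (q₂ + + 1)
  m R Z = q₂ * (q₂ + + 1)
  m R R = q₂ + + 1
  m R A = r₂ - (q₂ + + 1) * (q₂ + + 1)
  m Z _ = + 0

f : ℤ → ℤ → ℕ → ℤ
f a₁ a₂ zero          = + 1
f a₁ a₂ (suc zero)    = a₁ * + 1 + a₂ * + 0
f a₁ a₂ (suc (suc n)) = a₁ * f a₁ a₂ (suc n) + a₂ * f a₁ a₂ n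

QR : ℤ → ℤ → ℤ → ℤ → Set
QR a₁ a₂ q₂ r₂ =
  (a₁ + a₂ ≤ + 0 × + 0 < q₂ × + 0 < r₂ × + ∣ a₁ + a₂ ∣ ≡ q₂ * a₁ - r₂)
  ⊎ (+ 0 < a₁ + a₂ × q₂ ≡ + 0 × r₂ ≡ a₁ + a₂)

-- Count the nodes of each level by type, with signs.  Type-Z nodes are leaves, and a node of
-- type t has children of total signed weight equal to the value of t, so F (n+1) = a₁ α n + r₂ ρ n,
-- where α, ρ count the type-A and type-R nodes at level n.  The pair (α, ρ) evolves by the matrix
-- [[a₁ - (q₂+1), r₂ - (q₂+1)²], [1, q₂+1]], whose trace is a₁ and whose determinant is
-- (q₂+1) a₁ - r₂ = - a₂ by the choice of (q₂, r₂).  By Cayley–Hamilton both counts, hence F,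
-- satisfy the recurrence of f, and the first two values agree.
module Submission where

open import Defs
open import Data.Nat using (ℕ; zero; suc)
import Data.Nat as ℕ
open import Data.Integer using (ℤ; +_; _<_; _≤_; _+_; _*_; _-_; -_; ∣_∣; sign; _◃_)
open import Data.Integer.Properties
  using (+-assoc; +-identityˡ; +-identityʳ; *-identityˡ; *-identityʳ; *-comm; *-zeroʳ;
         ◃-inverse; ◃-distrib-*; +◃n≡+n; neg-mono-≤; 0≤i⇒+∣i∣≡i; ∣-i∣≡∣i∣)
open import Data.Integer.Tactic.RingSolver using (solve-∀)
open import Data.Sign using (Sign) renaming (_*_ to _*ₛ_)
import Data.Sign.Properties as Sign
open import Data.List using (List; []; _∷_; _++_; replicate; concatMap; map)
open import Data.List.Properties using (map-cong)
open import Data.Product using (_×_; _,_; proj₁; proj₂)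
open import Data.Sum using (inj₁; inj₂)
open import Function using (_∘_)
open import Relation.Binary.PropositionalEquality
open ≡-Reasoning

δ : Label → Label → ℤ
δ A A = + 1
δ R R = + 1
δ Z Z = + 1
δ _ _ = + 0

weightAt : Label → Node → ℤ
weightAt t x = δ (proj₁ x) t * (proj₂ x ◃ 1)

count : Label → List Node → ℤ
count t = sumℤ ∘ map (weightAt t)

δ-sym : ∀ s t → δ s t ≡ δ t s
δ-sym A A = refl
δ-sym A R = refl
δ-sym A Z = refl
δ-sym R A = refl
δ-sym R R = refl
δ-sym R Z = refl
δ-sym Z A = refl
δ-sym Z R = refl
δ-sym Z Z = refl

Σℓ : (Label → ℤ) → ℤ
Σℓ h = sumℤ (map h allLabels)

Σℓ-cong : ∀ {h k : Label → ℤ} → (∀ t → h t ≡ k t) → Σℓ h ≡ Σℓ k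
Σℓ-cong h≗k = cong sumℤ (map-cong h≗k allLabels)

Σℓ-δ : ∀ (h : Label → ℤ) t → Σℓ (λ s → δ s t * h s) ≡ h t
Σℓ-δ h A = trans (+-identityʳ _) (*-identityˡ (h A))
Σℓ-δ h R = trans (+-identityˡ _) (trans (+-identityʳ _) (*-identityˡ (h R)))
Σℓ-δ h Z = trans (+-identityˡ _) (trans (+-identityˡ _) (trans (+-identityʳ _) (*-identityˡ (h Z))))

Σℓ-+ : ∀ (h k : Label → ℤ) → Σℓ (λ t → h t + k t) ≡ Σℓ h + Σℓ k
Σℓ-+ h k = regroup (h A) (h R) (h Z) (k A) (k R) (k Z)
  where
  regroup : ∀ a b c a′ b′ c′ →
    (a + a′) + ((b + b′) + ((c + c′) + + 0)) ≡ (a + (b + (c + + 0))) + (a′ + (b′ + (c′ + + 0)))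
  regroup = solve-∀

count-++ : ∀ t xs ys → count t (xs ++ ys) ≡ count t xs + count t ys
count-++ t []       ys = sym (+-identityˡ (count t ys))
count-++ t (x ∷ xs) ys =
  trans (cong (_+_ (weightAt t x)) (count-++ t xs ys)) (sym (+-assoc (weightAt t x) (count t xs) (count t ys)))

count-concatMap : ∀ {A : Set} t (g : A → List Node) xs →
  count t (concatMap g xs) ≡ sumℤ (map (count t ∘ g) xs)
count-concatMap t g []       = refl
count-concatMap t g (x ∷ xs) =
  trans (count-++ t (g x) (concatMap g xs)) (cong (_+_ (count t (g x))) (count-concatMap t g xs))

count-replicate : ∀ t k x → count t (replicate k x) ≡ + k * weightAt t x
count-replicate t zero    x = refl
count-replicate t (suc k) x = begin
  w + count t (replicate k x) ≡⟨ cong (_+_ w) (count-replicate t k x) ⟩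
  w + + k * w                ≡⟨ expand w (+ k) ⟩
  + suc k * w                ∎
  where
  w = weightAt t x
  expand : ∀ w k → w + k * w ≡ (+ 1 + k) * w
  expand = solve-∀

+∣i∣*[s*sign-i◃1]≡[s◃1]*i : ∀ s i → + ∣ i ∣ * ((s *ₛ sign i) ◃ 1) ≡ (s ◃ 1) * i
+∣i∣*[s*sign-i◃1]≡[s◃1]*i s i = begin
  + ∣ i ∣ * (σ ◃ 1)                   ≡⟨ *-comm (+ ∣ i ∣) (σ ◃ 1) ⟩
  (σ ◃ 1) * + ∣ i ∣                   ≡⟨ cong ((σ ◃ 1) *_) (sym (+◃n≡+n ∣ i ∣)) ⟩
  (σ ◃ 1) * (Sign.+ ◃ ∣ i ∣)          ≡⟨ sym (◃-distrib-* σ Sign.+ 1 ∣ i ∣) ⟩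
  (σ *ₛ Sign.+) ◃ (1 ℕ.* ∣ i ∣)       ≡⟨ cong (_◃ (1 ℕ.* ∣ i ∣)) (Sign.*-identityʳ σ) ⟩
  σ ◃ (1 ℕ.* ∣ i ∣)                   ≡⟨ ◃-distrib-* s (sign i) 1 ∣ i ∣ ⟩
  (s ◃ 1) * (sign i ◃ ∣ i ∣)          ≡⟨ cong ((s ◃ 1) *_) (◃-inverse i) ⟩
  (s ◃ 1) * i                         ∎
  where σ = s *ₛ sign i

weightedSum≡Σℓ-count : ∀ (h : Label → ℤ) xs →
  sumℤ (map (λ x → (proj₂ x ◃ 1) * h (proj₁ x)) xs) ≡ Σℓ (λ s → h s * count s xs)
weightedSum≡Σℓ-count h []            = sym (Σℓ-cong (λ s → *-zeroʳ (h s)))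
weightedSum≡Σℓ-count h ((s₀ , ε) ∷ xs) = begin
  e * h s₀ + sumℤ (map (λ x → (proj₂ x ◃ 1) * h (proj₁ x)) xs)
    ≡⟨ cong (_+_ (e * h s₀)) (weightedSum≡Σℓ-count h xs) ⟩
  e * h s₀ + Σℓ (λ s → h s * count s xs)
    ≡⟨ cong (_+ Σℓ (λ s → h s * count s xs)) (sym (Σℓ-δ (λ s → e * h s) s₀)) ⟩
  Σℓ (λ s → δ s s₀ * (e * h s)) + Σℓ (λ s → h s * count s xs)
    ≡⟨ sym (Σℓ-+ (λ s → δ s s₀ * (e * h s)) (λ s → h s * count s xs)) ⟩
  Σℓ (λ s → δ s s₀ * (e * h s) + h s * count s xs)
    ≡⟨ Σℓ-cong (λ s → distrib (h s) (δ s s₀) e (count s xs)) ⟩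
  Σℓ (λ s → h s * (δ s s₀ * e + count s xs))
    ≡⟨ Σℓ-cong (λ s → cong (λ d → h s * (d * e + count s xs)) (δ-sym s s₀)) ⟩
  Σℓ (λ s → h s * count s ((s₀ , ε) ∷ xs)) ∎
  where
  e = ε ◃ 1
  distrib : ∀ h d e c → d * (e * h) + h * c ≡ h * (d * e + c)
  distrib = solve-∀

sumℤ-weights≡Σℓ-count : ∀ xs → sumℤ (map (λ x → proj₂ x ◃ 1) xs) ≡ Σℓ (λ t → count t xs)
sumℤ-weights≡Σℓ-count xs = begin
  sumℤ (map (λ x → proj₂ x ◃ 1) xs)
    ≡⟨ cong sumℤ (map-cong (λ x → sym (*-identityʳ (proj₂ x ◃ 1))) xs) ⟩
  sumℤ (map (λ x → (proj₂ x ◃ 1) * + 1) xs)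
    ≡⟨ weightedSum≡Σℓ-count (λ _ → + 1) xs ⟩
  Σℓ (λ t → + 1 * count t xs)
    ≡⟨ Σℓ-cong (λ t → *-identityˡ (count t xs)) ⟩
  Σℓ (λ t → count t xs) ∎

module _ (P : SuccessionRule) where
  open SuccessionRule P using (mult)

  count-children : ∀ t x → count t (children P x) ≡ (proj₂ x ◃ 1) * mult (proj₁ x) t
  count-children t (s , ε) = begin
    count t (children P (s , ε))
      ≡⟨ count-concatMap t (λ t′ → replicate ∣ mult s t′ ∣ (t′ , ε *ₛ sign (mult s t′))) allLabels ⟩
    Σℓ (λ t′ → count t (replicate ∣ mult s t′ ∣ (t′ , ε *ₛ sign (mult s t′))))
      ≡⟨ Σℓ-cong copies ⟩
    Σℓ (λ t′ → δ t′ t * ((ε ◃ 1) * mult s t′))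
      ≡⟨ Σℓ-δ (λ t′ → (ε ◃ 1) * mult s t′) t ⟩
    (ε ◃ 1) * mult s t ∎
    where
    swap : ∀ x y z → x * (y * z) ≡ y * (x * z)
    swap = solve-∀
    copies : ∀ t′ → count t (replicate ∣ mult s t′ ∣ (t′ , ε *ₛ sign (mult s t′)))
                    ≡ δ t′ t * ((ε ◃ 1) * mult s t′)
    copies t′ = begin
      count t (replicate ∣ mult s t′ ∣ (t′ , ε *ₛ sign (mult s t′)))
        ≡⟨ count-replicate t ∣ mult s t′ ∣ (t′ , ε *ₛ sign (mult s t′)) ⟩
      + ∣ mult s t′ ∣ * (δ t′ t * ((ε *ₛ sign (mult s t′)) ◃ 1))
        ≡⟨ swap (+ ∣ mult s t′ ∣) (δ t′ t) ((ε *ₛ sign (mult s t′)) ◃ 1) ⟩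
      δ t′ t * (+ ∣ mult s t′ ∣ * ((ε *ₛ sign (mult s t′)) ◃ 1))
        ≡⟨ cong (δ t′ t *_) (+∣i∣*[s*sign-i◃1]≡[s◃1]*i ε (mult s t′)) ⟩
      δ t′ t * ((ε ◃ 1) * mult s t′) ∎

  count-level-suc : ∀ t n →
    count t (level P (suc n)) ≡ Σℓ (λ s → mult s t * count s (level P n))
  count-level-suc t n = begin
    count t (level P (suc n))
      ≡⟨ count-concatMap t (children P) (level P n) ⟩
    sumℤ (map (count t ∘ children P) (level P n))
      ≡⟨ cong sumℤ (map-cong (count-children t) (level P n)) ⟩
    sumℤ (map (λ x → (proj₂ x ◃ 1) * mult (proj₁ x) t) (level P n))
      ≡⟨ weightedSum≡Σℓ-count (λ s → mult s t) (level P n) ⟩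
    Σℓ (λ s → mult s t * count s (level P n)) ∎

  F≡Σℓ-count : ∀ n → F P n ≡ Σℓ (λ t → count t (level P n))
  F≡Σℓ-count n = sumℤ-weights≡Σℓ-count (level P n)

record LinRec₂ (a b : ℤ) (g : ℕ → ℤ) : Set where
  constructor linRec₂
  field step : ∀ n → g (suc (suc n)) ≡ a * g (suc n) + b * g n

LinRec₂-unique : ∀ {a b} {g h : ℕ → ℤ} → LinRec₂ a b g → LinRec₂ a b h →
  g 0 ≡ h 0 → g 1 ≡ h 1 → ∀ n → g n ≡ h n
LinRec₂-unique g-rec h-rec g₀≡h₀ g₁≡h₁ zero          = g₀≡h₀
LinRec₂-unique g-rec h-rec g₀≡h₀ g₁≡h₁ (suc zero)    = g₁≡h₁
LinRec₂-unique {a} {b} {g} {h} g-rec h-rec g₀≡h₀ g₁≡h₁ (suc (suc n)) = begin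
  g (suc (suc n))           ≡⟨ LinRec₂.step g-rec n ⟩
  a * g (suc n) + b * g n   ≡⟨ cong₂ (λ u v → a * u + b * v) (g≗h (suc n)) (g≗h n) ⟩
  a * h (suc n) + b * h n   ≡⟨ sym (LinRec₂.step h-rec n) ⟩
  h (suc (suc n))           ∎
  where g≗h = LinRec₂-unique g-rec h-rec g₀≡h₀ g₁≡h₁

f∘suc-LinRec₂ : ∀ a₁ a₂ → LinRec₂ a₁ a₂ (f a₁ a₂ ∘ suc)
f∘suc-LinRec₂ a₁ a₂ = linRec₂ λ _ → refl

LinRec₂-linear : ∀ {a b} (x y : ℕ → ℤ) c d → LinRec₂ a b x → LinRec₂ a b y →
  LinRec₂ a b (λ n → c * x n + d * y n)
LinRec₂-linear {a} {b} x y c d x-rec y-rec = linRec₂ λ n → begin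
  c * x (suc (suc n)) + d * y (suc (suc n))
    ≡⟨ cong₂ (λ u v → c * u + d * v) (LinRec₂.step x-rec n) (LinRec₂.step y-rec n) ⟩
  c * (a * x (suc n) + b * x n) + d * (a * y (suc n) + b * y n)
    ≡⟨ regroup a b c d (x (suc n)) (x n) (y (suc n)) (y n) ⟩
  a * (c * x (suc n) + d * y (suc n)) + b * (c * x n + d * y n) ∎
  where
  regroup : ∀ a b c d x₁ x₀ y₁ y₀ →
    c * (a * x₁ + b * x₀) + d * (a * y₁ + b * y₀) ≡ a * (c * x₁ + d * y₁) + b * (c * x₀ + d * y₀)
  regroup = solve-∀

cayley-hamilton₂ : ∀ (p s u v : ℤ) (x y : ℕ → ℤ) →
  (∀ n → x (suc n) ≡ p * x n + s * y n) →
  (∀ n → y (suc n) ≡ u * x n + v * y n) →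
  LinRec₂ (p + v) (s * u - p * v) x × LinRec₂ (p + v) (s * u - p * v) y
cayley-hamilton₂ p s u v x y x-suc y-suc = linRec₂ x-rec , linRec₂ y-rec
  where
  eliminateˣ : ∀ p s u v x y → p * (p * x + s * y) + s * (u * x + v * y)
                       ≡ (p + v) * (p * x + s * y) + (s * u - p * v) * x
  eliminateˣ = solve-∀
  eliminateʸ : ∀ p s u v x y → u * (p * x + s * y) + v * (u * x + v * y)
                       ≡ (p + v) * (u * x + v * y) + (s * u - p * v) * y
  eliminateʸ = solve-∀
  x-rec : ∀ n → x (suc (suc n)) ≡ (p + v) * x (suc n) + (s * u - p * v) * x n
  x-rec n = begin
    x (suc (suc n))                                    ≡⟨ x-suc (suc n) ⟩
    p * x (suc n) + s * y (suc n)                      ≡⟨ cong₂ (λ X Y → p * X + s * Y) (x-suc n) (y-suc n) ⟩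
    p * (p * x n + s * y n) + s * (u * x n + v * y n)  ≡⟨ eliminateˣ p s u v (x n) (y n) ⟩
    (p + v) * (p * x n + s * y n) + (s * u - p * v) * x n
      ≡⟨ cong (λ X → (p + v) * X + (s * u - p * v) * x n) (sym (x-suc n)) ⟩
    (p + v) * x (suc n) + (s * u - p * v) * x n        ∎
  y-rec : ∀ n → y (suc (suc n)) ≡ (p + v) * y (suc n) + (s * u - p * v) * y n
  y-rec n = begin
    y (suc (suc n))                                    ≡⟨ y-suc (suc n) ⟩
    u * x (suc n) + v * y (suc n)                      ≡⟨ cong₂ (λ X Y → u * X + v * Y) (x-suc n) (y-suc n) ⟩
    u * (p * x n + s * y n) + v * (u * x n + v * y n)  ≡⟨ eliminateʸ p s u v (x n) (y n) ⟩
    (p + v) * (u * x n + v * y n) + (s * u - p * v) * y n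
      ≡⟨ cong (λ Y → (p + v) * Y + (s * u - p * v) * y n) (sym (y-suc n)) ⟩
    (p + v) * y (suc n) + (s * u - p * v) * y n        ∎

i≤0⇒+∣i∣≡-i : ∀ {i} → i ≤ + 0 → + ∣ i ∣ ≡ - i
i≤0⇒+∣i∣≡-i {i} i≤0 = trans (cong +_ (sym (∣-i∣≡∣i∣ i))) (0≤i⇒+∣i∣≡i (neg-mono-≤ i≤0))

QR⇒a₂≡r₂-[q₂+1]a₁ : ∀ {a₁ a₂ q₂ r₂} → QR a₁ a₂ q₂ r₂ → a₂ ≡ r₂ - (q₂ + + 1) * a₁
QR⇒a₂≡r₂-[q₂+1]a₁ {a₁} {a₂} {q₂} {r₂} (inj₁ (a₁+a₂≤0 , _ , _ , ∣a₁+a₂∣≡)) = begin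
  a₂                         ≡⟨ negate-twice a₁ a₂ ⟩
  - (- (a₁ + a₂)) - a₁       ≡⟨ cong (λ z → - z - a₁) (sym (i≤0⇒+∣i∣≡-i a₁+a₂≤0)) ⟩
  - (+ ∣ a₁ + a₂ ∣) - a₁     ≡⟨ cong (λ z → - z - a₁) ∣a₁+a₂∣≡ ⟩
  - (q₂ * a₁ - r₂) - a₁      ≡⟨ collect a₁ q₂ r₂ ⟩
  r₂ - (q₂ + + 1) * a₁       ∎
  where
  negate-twice : ∀ a b → b ≡ - (- (a + b)) - a
  negate-twice = solve-∀
  collect : ∀ a q r → - (q * a - r) - a ≡ r - (q + + 1) * a
  collect = solve-∀
QR⇒a₂≡r₂-[q₂+1]a₁ {a₁} {a₂} (inj₂ (_ , refl , refl)) = cancel a₁ a₂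
  where
  cancel : ∀ a b → b ≡ (a + b) - (+ 0 + + 1) * a
  cancel = solve-∀

module RuleCounts (a₁ a₂ q₂ r₂ : ℤ) (a₂≡ : a₂ ≡ r₂ - (q₂ + + 1) * a₁) where
  P : SuccessionRule
  P = rule a₁ q₂ r₂

  α ρ : ℕ → ℤ
  α n = count A (level P n)
  ρ n = count R (level P n)

  α-suc : ∀ n → α (suc n) ≡ (a₁ - (q₂ + + 1)) * α n + (r₂ - (q₂ + + 1) * (q₂ + + 1)) * ρ n
  α-suc n = trans (count-level-suc P A n)
                  (cong (_+_ ((a₁ - (q₂ + + 1)) * α n)) (+-identityʳ _))

  ρ-suc : ∀ n → ρ (suc n) ≡ + 1 * α n + (q₂ + + 1) * ρ n
  ρ-suc n = trans (count-level-suc P R n) (cong (_+_ (+ 1 * α n)) (+-identityʳ _))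

  F-suc : ∀ n → F P (suc n) ≡ a₁ * α n + r₂ * ρ n
  F-suc n = begin
    F P (suc n)
      ≡⟨ F≡Σℓ-count P (suc n) ⟩
    α (suc n) + (ρ (suc n) + (ζ (suc n) + + 0))
      ≡⟨ cong₃ (λ u v w → u + (v + (w + + 0))) (α-suc n) (ρ-suc n) (ζ-suc n) ⟩
    (p * α n + s * ρ n) + ((+ 1 * α n + (q₂ + + 1) * ρ n) + ((q₂ * α n + (q₂ * (q₂ + + 1) * ρ n + + 0)) + + 0))
      ≡⟨ row-sums a₁ q₂ r₂ (α n) (ρ n) ⟩
    a₁ * α n + r₂ * ρ n ∎
    where
    p = a₁ - (q₂ + + 1)
    s = r₂ - (q₂ + + 1) * (q₂ + + 1)
    ζ : ℕ → ℤ
    ζ n = count Z (level P n)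
    ζ-suc : ∀ n → ζ (suc n) ≡ q₂ * α n + (q₂ * (q₂ + + 1) * ρ n + + 0)
    ζ-suc = count-level-suc P Z
    cong₃ : ∀ (g : ℤ → ℤ → ℤ → ℤ) {u u′ v v′ w w′} → u ≡ u′ → v ≡ v′ → w ≡ w′ → g u v w ≡ g u′ v′ w′
    cong₃ g refl refl refl = refl
    row-sums : ∀ a q r x y →
      ((a - (q + + 1)) * x + (r - (q + + 1) * (q + + 1)) * y)
      + ((+ 1 * x + (q + + 1) * y) + ((q * x + (q * (q + + 1) * y + + 0)) + + 0))
      ≡ a * x + r * y
    row-sums = solve-∀

  α-rec×ρ-rec : LinRec₂ a₁ a₂ α × LinRec₂ a₁ a₂ ρ
  α-rec×ρ-rec = subst₂ (λ a b → LinRec₂ a b α × LinRec₂ a b ρ) (trace a₁ q₂) det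
                       (cayley-hamilton₂ (a₁ - (q₂ + + 1)) (r₂ - (q₂ + + 1) * (q₂ + + 1)) (+ 1) (q₂ + + 1)
                                         α ρ α-suc ρ-suc)
    where
    trace : ∀ a q → (a - (q + + 1)) + (q + + 1) ≡ a
    trace = solve-∀
    det′ : ∀ a q r → (r - (q + + 1) * (q + + 1)) * + 1 - (a - (q + + 1)) * (q + + 1) ≡ r - (q + + 1) * a
    det′ = solve-∀
    det : (r₂ - (q₂ + + 1) * (q₂ + + 1)) * + 1 - (a₁ - (q₂ + + 1)) * (q₂ + + 1) ≡ a₂
    det = trans (det′ a₁ q₂ r₂) (sym a₂≡)

  F-suc≡f : ∀ n → F P (suc n) ≡ f a₁ a₂ (suc n)
  F-suc≡f n = trans (F-suc n) (LinRec₂-unique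
                      (LinRec₂-linear α ρ a₁ r₂ (proj₁ α-rec×ρ-rec) (proj₂ α-rec×ρ-rec))
                      (f∘suc-LinRec₂ a₁ a₂) level₀ level₁ n)
    where
    level₀ : a₁ * + 1 + r₂ * + 0 ≡ a₁ * + 1 + a₂ * + 0
    level₀ = cong (_+_ (a₁ * + 1)) (trans (*-zeroʳ r₂) (sym (*-zeroʳ a₂)))
    level₁′ : ∀ a q r → a * ((a - (q + + 1)) * + 1 + (r - (q + + 1) * (q + + 1)) * + 0)
                        + r * (+ 1 * + 1 + (q + + 1) * + 0)
                        ≡ a * (a * + 1 + (r - (q + + 1) * a) * + 0) + (r - (q + + 1) * a) * + 1
    level₁′ = solve-∀
    level₁ : a₁ * α 1 + r₂ * ρ 1 ≡ f a₁ a₂ 2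
    level₁ = begin
      a₁ * α 1 + r₂ * ρ 1
        ≡⟨ cong₂ (λ u v → a₁ * u + r₂ * v) (α-suc 0) (ρ-suc 0) ⟩
      a₁ * ((a₁ - (q₂ + + 1)) * + 1 + (r₂ - (q₂ + + 1) * (q₂ + + 1)) * + 0)
        + r₂ * (+ 1 * + 1 + (q₂ + + 1) * + 0)
        ≡⟨ level₁′ a₁ q₂ r₂ ⟩
      a₁ * (a₁ * + 1 + (r₂ - (q₂ + + 1) * a₁) * + 0) + (r₂ - (q₂ + + 1) * a₁) * + 1
        ≡⟨ cong (λ b → a₁ * (a₁ * + 1 + b * + 0) + b * + 1) (sym a₂≡) ⟩
      f a₁ a₂ 2 ∎

proposition3 : (a₁ a₂ : ℤ) → + 0 < a₁ → (q₂ r₂ : ℤ) → QR a₁ a₂ q₂ r₂ →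
    (n : ℕ) → F (rule a₁ q₂ r₂) n ≡ f a₁ a₂ n
proposition3 a₁ a₂ _ q₂ r₂ qr zero    = refl
proposition3 a₁ a₂ _ q₂ r₂ qr (suc n) = RuleCounts.F-suc≡f a₁ a₂ q₂ r₂ (QR⇒a₂≡r₂-[q₂+1]a₁ qr) n
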